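{- Let $A=(Q,q_0,\Sigma,\delta,\alpha)$ be a limit-deterministic Büchi automaton with deterministic trap $Q_d$, let ${\sf Ord}$ be an ordering of the states of $A$ with respect to $Q_d$, and let $w\in\Sigma^\omega$. Then the color summary of the run DAG $G_w$ is even if and only if there is an accepting run in $G_w$ (i.e. iff $w\in\mathsf L(A)$).
   Context: A (transition-based) Büchi automaton is $A=(Q,q_0,\Sigma,\delta,\alpha)$ with $Q$ finite, $q_0\in Q$, $\Sigma$ finite, $\delta\subseteq Q\times\Sigma\times Q$ total, $\alpha\subseteq\delta$. A run on $w$ is $\rho:\mathbb N\to Q$ with $\rho(0)=q_0$ and $(\rho(i),w(i),\rho(i+1))\in\delta$ for all $i$; it is accepting if $(\rho(i),w(i),\rho(i+1))\in\alpha$ for infinitely many $i$; $\mathsf L(A)$ is the set of words with an accepting run. $A$ is limit-deterministic (LDBA) w.r.t. $Q_d\subseteq Q$ if (1) $\alpha\subseteq Q_d\times\Sigma\times Q_d$; (2) each $q\in Q_d$ has at most one $\sigma$-successor for every $\sigma$; (3) all successors of states in $Q_d$ lie in $Q_d$; and $q_0\notin Q_d$. Run DAG $G_w=(V,E)$: $V=\bigcup_i V_i$, $V_0=\{(q_0,0)\}$, $V_i=\{(q,i)\mid\exists(q',i-1)\in V_{i-1}:(q',w(i-1),q)\in\delta\}$, $E=\{((q,i),(q',i+1))\in V_i\times V_{i+1}\mid (q,w(i),q')\in\delta\}$; $V^d_i=V_i\cap(Q_d\times\{i\})$. Runs of $A$ on $w$ correspond to infinite paths from $(q_0,0)$; such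 a path is accepting if infinitely many of its edges $((q,i),(q',i+1))$ satisfy $(q,w(i),q')\in\alpha$. An ordering w.r.t. $Q_d$ is ${\sf Ord}:Q\to\{1,\dots,|Q_d|,+\infty\}$, equal to $+\infty$ exactly outside $Q_d$ and injective on $Q_d$; ${\sf Ord}((q,i))={\sf Ord}(q)$. Run prefixes (paths from $(q_0,0)$) of equal length are compared by $\sqsubseteq$, the lexicographic order on their sequences of ${\sf Ord}$-values. For distinct $v,v'\in V_i$, $v\sqsubset_i v'$ iff some run prefix ending in $v$ is $\sqsubseteq$-smaller than all run prefixes ending in $v'$; this is a total order on $V^d_i$. ${\sf Ind}_i(v)\in\{1,\dots,|Q_d|\}$ is the position of $v\in V^d_i$ in this order (smallest has index 1). ${\sf Dec}(V^d_i)$ is the set of $v\in V^d_i$ having a successor $v'\in V^d_{i+1}$ with ${\sf Ind}_{i+1}(v')<{\sf Ind}_i(v)$; ${\sf Acc}(V^d_i)$ is the set of $v=(q,i)\in V^d_i$ having a successor $(q',i+1)\in V^d_{i+1}$ with $(q,w(i),q')\in\alpha$. The color of the step from level $i$ to $i+1$ is: if ${\sf Dec}=\emptyset\neq{\sf Acc}$: $2\min_{v\in{\sf Acc}(V^d_i)}{\sf Ind}_i(v)$; if ${\sf Acc}=\emptyset\neq{\sf Dec}$: $2\min_{v\in{\sf Dec}(V^d_i)}{\sf Ind}_i(v)-1$; if both nonempty: the minimum of these two numbers; if both empty: $2|Q_d|+1$. The color summary of $G_w$ is the minimal color occurring at infinitely many levels. -}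

module Defs where

open import Level using (0ℓ)
open import Data.Nat using (ℕ; zero; suc; _+_; _*_; _∸_; _≤_; _<_; _⊓_)
open import Data.Nat.Divisibility using (_∣_)
open import Data.Fin using (Fin)
open import Data.Fin.Subset using (Subset; _∈_; _∉_; ∣_∣)
open import Data.Bool using (Bool; T)
open import Data.Product using (Σ; ∃; _×_; _,_)
open import Data.Sum using (_⊎_)
open import Relation.Nullary using (¬_)
open import Relation.Binary.PropositionalEquality using (_≡_)

record Buchi (n k : ℕ) : Set where
  field
    q₀    : Fin n
    δ     : Fin n → Fin k → Fin n → Bool
    α     : Fin n → Fin k → Fin n → Bool
    total : ∀ q σ → ∃ λ q' → T (δ q σ q')
    α⊆δ   : ∀ q σ q' → T (α q σ q') → T (δ q σ q')

Word : ℕ → Set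
Word k = ℕ → Fin k

module _ {n k : ℕ} (A : Buchi n k) where
  open Buchi A

  record IsLDBA (Qd : Subset n) : Set where
    field
      accInQd  : ∀ q σ q' → T (α q σ q') → (q ∈ Qd) × (q' ∈ Qd)
      det      : ∀ q σ q' q'' → q ∈ Qd → T (δ q σ q') → T (δ q σ q'') → q' ≡ q''
      closed   : ∀ q σ q' → q ∈ Qd → T (δ q σ q') → q' ∈ Qd
      q₀∉Qd    : q₀ ∉ Qd

  IsRun : Word k → (ℕ → Fin n) → Set
  IsRun w ρ = (ρ 0 ≡ q₀) × (∀ i → T (δ (ρ i) (w i) (ρ (suc i))))

  IsAcceptingRun : Word k → (ℕ → Fin n) → Set
  IsAcceptingRun w ρ = IsRun w ρ ×
    (∀ N → ∃ λ i → N ≤ i × T (α (ρ i) (w i) (ρ (suc i))))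

  Accepts : Word k → Set
  Accepts w = ∃ λ ρ → IsAcceptingRun w ρ

data ℕ∞ : Set where
  fin : ℕ → ℕ∞
  ∞   : ℕ∞

data _<∞_ : ℕ∞ → ℕ∞ → Set where
  fin<fin : ∀ {a b} → a < b → fin a <∞ fin b
  fin<∞   : ∀ {a} → fin a <∞ ∞

record IsOrdering {n : ℕ} (Qd : Subset n) (Ord : Fin n → ℕ∞) : Set where
  field
    inRange : ∀ q → q ∈ Qd → ∃ λ j → (Ord q ≡ fin j) × (1 ≤ j) × (j ≤ ∣ Qd ∣)
    outside : ∀ q → q ∉ Qd → Ord q ≡ ∞
    injQd   : ∀ q q' → q ∈ Qd → q' ∈ Qd → Ord q ≡ Ord q' → q ≡ q'

module RunDAG {n k : ℕ} (A : Buchi n k) (Qd : Subset n) (Ord : Fin n → ℕ∞)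
              (w : Word k) where
  open Buchi A

  data InV : ℕ → Fin n → Set where
    base : InV 0 q₀
    step : ∀ {i q' q} → InV i q' → T (δ q' (w i) q) → InV (suc i) q

  InVd : ℕ → Fin n → Set
  InVd i q = InV i q × q ∈ Qd

  -- run prefixes of length i (positions 0..i); values beyond i are irrelevant
  IsPrefix : ℕ → (ℕ → Fin n) → Set
  IsPrefix i ρ = (ρ 0 ≡ q₀) × (∀ j → j < i → T (δ (ρ j) (w j) (ρ (suc j))))

  LexLt : ℕ → (ℕ → Fin n) → (ℕ → Fin n) → Set
  LexLt i ρ ρ' = ∃ λ j → j ≤ i × (∀ l → l < j → Ord (ρ l) ≡ Ord (ρ' l))
                       × (Ord (ρ j) <∞ Ord (ρ' j))

  _⊏[_]_ : Fin n → ℕ → Fin n → Set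
  q ⊏[ i ] q' = ¬ (q ≡ q') × ∃ λ ρ → IsPrefix i ρ × (ρ i ≡ q) ×
                 (∀ ρ' → IsPrefix i ρ' → ρ' i ≡ q' → LexLt i ρ ρ')

  Ind : ℕ → Fin n → ℕ → Set
  Ind i q j = InVd i q × ∃ λ (S : Subset n) →
                (∀ u → u ∈ S → InVd i u × u ⊏[ i ] q) ×
                (∀ u → InVd i u → u ⊏[ i ] q → u ∈ S) ×
                (j ≡ suc ∣ S ∣)

  InDec : ℕ → Fin n → Set
  InDec i q = InVd i q × ∃ λ q' → T (δ q (w i) q') × InVd (suc i) q' ×
              ∃ λ j → ∃ λ j' → Ind i q j × Ind (suc i) q' j' × j' < j

  InAcc : ℕ → Fin n → Set
  InAcc i q = InVd i q × ∃ λ q' → InVd (suc i) q' × T (α q (w i) q')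

  MinInd : ℕ → (Fin n → Set) → ℕ → Set
  MinInd i P m = (∃ λ q → P q × Ind i q m) × (∀ q j → P q → Ind i q j → m ≤ j)

  Empty : (Fin n → Set) → Set
  Empty P = ∀ q → ¬ P q

  Color : ℕ → ℕ → Set
  Color i c =
      (Empty (InDec i) × Empty (InAcc i) × c ≡ 2 * ∣ Qd ∣ + 1)
    ⊎ (Empty (InDec i) × ∃ λ m → MinInd i (InAcc i) m × c ≡ 2 * m)
    ⊎ (Empty (InAcc i) × ∃ λ m → MinInd i (InDec i) m × c ≡ 2 * m ∸ 1)
    ⊎ (∃ λ m → ∃ λ m' → MinInd i (InAcc i) m × MinInd i (InDec i) m'
                       × c ≡ (2 * m) ⊓ (2 * m' ∸ 1))

  InfOften : (ℕ → Set) → Set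
  InfOften P = ∀ N → ∃ λ i → N ≤ i × P i

  IsColorSummary : ℕ → Set
  IsColorSummary c = InfOften (λ i → Color i c) ×
                     (∀ c' → c' < c → ¬ InfOften (λ i → Color i c'))

  ColorSummaryEven : Set
  ColorSummaryEven = ∃ λ c → IsColorSummary c × 2 ∣ c

-- The index of a node of V^d never increases along an edge: the nodes ranked below a successor have
-- pairwise distinct predecessors ranked below the node itself (determinism on Q_d, and a prefix witnessing
-- u′ ⊏ v′ passes through a predecessor of u′ that is ⊏ the predecessor of v′). An edge that keeps the index
-- turns `next` into an order-preserving bijection between the nodes below its ends, so no node of at most
-- that index lies in Dec. Along an accepting run the index therefore stabilises at some m, after which no
-- colour below 2m occurs while the run is in Acc with index m infinitely often: the summary is even.
-- Conversely, if the summary is 2m, then from some point on there is no colour below 2m, and the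
-- deterministic run from an Acc node of index m keeps index m; whenever colour 2m recurs its Acc node of
-- index m is that run, which is therefore accepting.
module Submission where

open import Level using (0ℓ)
open import Axiom.ExcludedMiddle using (ExcludedMiddle)
open import Data.Bool using (T)
open import Data.Bool.Properties using (T-≡)
open import Data.Empty using (⊥; ⊥-elim)
open import Data.Fin using (Fin; zero; suc)
open import Data.Fin.Properties using (_≟_)
open import Data.Fin.Subset using (Subset; _∈_; _∉_; _-_; ∣_∣; _⊂_; _⊆_; inside; outside)
open import Data.Fin.Subset.Induction using (⊂-wellFounded)
open import Data.Fin.Subset.Properties
  using (_∈?_; ⊆-antisym; p⊂q⇒∣p∣<∣q∣; p─⊥≡p; p─q⊆p; x∈p∧x≢y⇒x∈p-y; x∈p⇒p-x⊂p; x∈p⇒∣p-x∣<∣p∣;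
         nonempty?; Empty-unique; ∣⊥∣≡0)
open import Data.Nat using (ℕ; zero; suc; _*_; _∸_; _≤_; _<_; z≤n; s≤s; _⊔_; _≤?_)
open import Data.Nat.Divisibility using (_∣_; divides; _∣?_)
open import Data.Nat.Induction using (<-wellFounded)
open import Data.Nat.InfinitelyOften as Often using (_∪-Fin_)
open import Data.Nat.Properties
  using (≤-refl; ≤-reflexive; ≤-trans; ≤-antisym; ≤-pred; <-trans; <-irrefl; <-cmp; <⇒≤; ≤-<-trans;
         <-≤-trans; ≮⇒≥; 1+n≰n; n≤0⇒n≡0; m<n⇒m<1+n; m≤n⇒m≤1+n; m≤n⇒m<n∨m≡n; m≤m⊔n; m≤n⊔m;
         m⊓n≤m; m⊓n≤n; ⊓-sel; +-comm; *-comm; *-suc; *-monoʳ-≤; *-cancelˡ-≡; *-cancelˡ-<; ∸-monoˡ-≤;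
         even≢odd; module ≤-Reasoning)
open import Data.Product using (∃; _×_; _,_; proj₁; proj₂; curry; uncurry)
open import Data.Sum using (_⊎_; inj₁; inj₂)
open import Data.Vec using (_∷_; here; there; tabulate)
open import Data.Vec.Properties using (lookup∘tabulate; []=⇒lookup; lookup⇒[]=)
open import Function using (_∘_)
open import Function.Bundles using (Equivalence; _⇔_; mk⇔)
open import Induction.WellFounded using (WellFounded; Acc; acc)
open import Relation.Binary.Core using (Rel)
import Relation.Binary.Construct.On as On
open import Relation.Binary.Definitions using (Trichotomous; tri<; tri≈; tri>)
open import Relation.Binary.PropositionalEquality
open import Relation.Binary.Structures using (IsStrictTotalOrder)
open import Relation.Nullary using (¬_; yes; no)
open import Relation.Nullary.Decidable using (isYes; toWitness; fromWitness)

open import Defs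

∣p∣≡1+∣p-x∣ : ∀ {n} {p : Subset n} {x} → x ∈ p → ∣ p ∣ ≡ suc ∣ p - x ∣
∣p∣≡1+∣p-x∣ {p = inside ∷ p} here = cong (λ s → suc ∣ s ∣) (sym (p─⊥≡p p))
∣p∣≡1+∣p-x∣ {p = inside ∷ p} (there x∈p) = cong suc (∣p∣≡1+∣p-x∣ x∈p)
∣p∣≡1+∣p-x∣ {p = outside ∷ p} (there x∈p) = ∣p∣≡1+∣p-x∣ x∈p

x∉p-x : ∀ {n} {p : Subset n} x → x ∉ p - x
x∉p-x {p = _ ∷ _} zero ()
x∉p-x {p = _ ∷ _} (suc x) (there x∈p-x) = x∉p-x x x∈p-x

matching⇒∣p∣≤∣q∣ : ∀ {m n} {R : Fin m → Fin n → Set} {p : Subset m} {q : Subset n} →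
  (∀ {x} → x ∈ p → ∃ λ y → y ∈ q × R x y) →
  (∀ {x x′ y} → x ∈ p → x′ ∈ p → y ∈ q → R x y → R x′ y → x ≡ x′) →
  ∣ p ∣ ≤ ∣ q ∣
matching⇒∣p∣≤∣q∣ {m} {R = R} {p} {q} = go p (⊂-wellFounded p) q
  where
  go : ∀ p → Acc _⊂_ p → ∀ q →
       (∀ {x} → x ∈ p → ∃ λ y → y ∈ q × R x y) →
       (∀ {x x′ y} → x ∈ p → x′ ∈ p → y ∈ q → R x y → R x′ y → x ≡ x′) →
       ∣ p ∣ ≤ ∣ q ∣
  go p (acc rec) q match unique with nonempty? p
  ... | no p-empty = subst (_≤ ∣ q ∣) (sym (trans (cong ∣_∣ (Empty-unique p-empty)) (∣⊥∣≡0 m))) z≤n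
  ... | yes (x , x∈p) with match x∈p
  ...   | y , y∈q , Rxy = subst (_≤ ∣ q ∣) (sym (∣p∣≡1+∣p-x∣ x∈p)) (≤-trans (s≤s rest) (x∈p⇒∣p-x∣<∣p∣ y∈q))
    where
    rest : ∣ p - x ∣ ≤ ∣ q - y ∣
    rest = go (p - x) (rec (x∈p⇒p-x⊂p x∈p)) (q - y) match′ unique′
      where
      match′ : ∀ {x′} → x′ ∈ p - x → ∃ λ y′ → y′ ∈ q - y × R x′ y′
      match′ {x′} x′∈p-x with match (p─q⊆p _ _ x′∈p-x)
      ... | y′ , y′∈q , Rx′y′ = y′ , x∈p∧x≢y⇒x∈p-y y′∈q y′≢y , Rx′y′
        where
        y′≢y : y′ ≢ y
        y′≢y refl = x∉p-x x (subst (_∈ p - x) (unique (p─q⊆p _ _ x′∈p-x) x∈p y∈q Rx′y′ Rxy) x′∈p-x)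
      unique′ : ∀ {x₁ x₂ y′} → x₁ ∈ p - x → x₂ ∈ p - x → y′ ∈ q - y → R x₁ y′ → R x₂ y′ → x₁ ≡ x₂
      unique′ h₁ h₂ h = unique (p─q⊆p _ _ h₁) (p─q⊆p _ _ h₂) (p─q⊆p _ _ h)

<∞-irrefl : ∀ {a} → ¬ (a <∞ a)
<∞-irrefl (fin<fin a<a) = <-irrefl refl a<a

<∞-trans : ∀ {a b c} → a <∞ b → b <∞ c → a <∞ c
<∞-trans (fin<fin a<b) (fin<fin b<c) = fin<fin (<-trans a<b b<c)
<∞-trans (fin<fin _)   fin<∞         = fin<∞

<∞-cmp : Trichotomous _≡_ _<∞_
<∞-cmp (fin a) (fin b) with <-cmp a b
... | tri< a<b a≢b a≯b = tri< (fin<fin a<b) (λ { refl → a≢b refl }) (λ { (fin<fin b<a) → a≯b b<a })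
... | tri≈ a≮b refl a≯b = tri≈ (λ { (fin<fin a<b) → a≮b a<b }) refl (λ { (fin<fin b<a) → a≯b b<a })
... | tri> a≮b a≢b a>b = tri> (λ { (fin<fin a<b) → a≮b a<b }) (λ { refl → a≢b refl }) (fin<fin a>b)
<∞-cmp (fin a) ∞ = tri< fin<∞ (λ ()) (λ ())
<∞-cmp ∞ (fin b) = tri> (λ ()) (λ ()) fin<∞
<∞-cmp ∞ ∞ = tri≈ (λ ()) refl (λ ())

<∞-isStrictTotalOrder : IsStrictTotalOrder _≡_ _<∞_
<∞-isStrictTotalOrder = record
  { isStrictPartialOrder = record
    { isEquivalence = isEquivalence
    ; irrefl = λ { refl → <∞-irrefl }
    ; trans = <∞-trans
    ; <-resp-≈ = resp₂ _<∞_
    }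
  ; compare = <∞-cmp
  }

<∞⇒≢∞ : ∀ {a b} → a <∞ b → a ≢ ∞
<∞⇒≢∞ (fin<fin _) ()
<∞⇒≢∞ fin<∞       ()

Acc-fin : ∀ {a} → Acc _<_ a → Acc _<∞_ (fin a)
Acc-fin (acc rec) = acc λ { (fin<fin b<a) → Acc-fin (rec b<a) }

<∞-wellFounded : WellFounded _<∞_
<∞-wellFounded (fin a) = Acc-fin (<-wellFounded a)
<∞-wellFounded ∞       = acc λ { fin<∞ → Acc-fin (<-wellFounded _) }

module Lexicographic {A : Set} {_≺_ : Rel A 0ℓ} (≺-sto : IsStrictTotalOrder _≡_ _≺_) where
  open IsStrictTotalOrder ≺-sto using (compare) renaming (trans to ≺-trans; irrefl to ≺-irrefl)

  infix 4 _<[_]_ _≈[_]_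

  _<[_]_ : (ℕ → A) → ℕ → (ℕ → A) → Set
  a <[ i ] b = ∃ λ j → j ≤ i × (∀ l → l < j → a l ≡ b l) × a j ≺ b j

  _≈[_]_ : (ℕ → A) → ℕ → (ℕ → A) → Set
  a ≈[ i ] b = ∀ l → l ≤ i → a l ≡ b l

  ≈-sym : ∀ {i a b} → a ≈[ i ] b → b ≈[ i ] a
  ≈-sym a≈b l l≤i = sym (a≈b l l≤i)

  ≈-trans : ∀ {i a b c} → a ≈[ i ] b → b ≈[ i ] c → a ≈[ i ] c
  ≈-trans a≈b b≈c l l≤i = trans (a≈b l l≤i) (b≈c l l≤i)

  lex-irrefl : ∀ {i a} → ¬ (a <[ i ] a)
  lex-irrefl (_ , _ , _ , aj<aj) = ≺-irrefl refl aj<aj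

  lex-trans : ∀ {i a b c} → a <[ i ] b → b <[ i ] c → a <[ i ] c
  lex-trans {a = a} {b} {c} (j , j≤i , a≈b , aj<bj) (k , k≤i , b≈c , bk<ck) with <-cmp j k
  ... | tri< j<k _ _ = j , j≤i , (λ l l<j → trans (a≈b l l<j) (b≈c l (<-trans l<j j<k))) ,
                       subst (a j ≺_) (b≈c j j<k) aj<bj
  ... | tri≈ _ refl _ = j , j≤i , (λ l l<j → trans (a≈b l l<j) (b≈c l l<j)) , ≺-trans aj<bj bk<ck
  ... | tri> _ _ k<j = k , k≤i , (λ l l<k → trans (a≈b l (<-trans l<k k<j)) (b≈c l l<k)) ,
                       subst (_≺ c k) (sym (a≈b k k<j)) bk<ck

  lex-respʳ-≈ : ∀ {i a b c} → a <[ i ] b → b ≈[ i ] c → a <[ i ] c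
  lex-respʳ-≈ {a = a} (j , j≤i , a≈b , aj<bj) b≈c =
    j , j≤i , (λ l l<j → trans (a≈b l l<j) (b≈c l (≤-trans (<⇒≤ l<j) j≤i))) , subst (a j ≺_) (b≈c j j≤i) aj<bj

  lex-weaken : ∀ {i a b} → a <[ i ] b → a <[ suc i ] b
  lex-weaken (j , j≤i , a≈b , aj<bj) = j , m≤n⇒m≤1+n j≤i , a≈b , aj<bj

  lex-last : ∀ {i a b} → a ≈[ i ] b → a (suc i) ≺ b (suc i) → a <[ suc i ] b
  lex-last a≈b last< = suc _ , ≤-refl , (λ l l<1+i → a≈b l (≤-pred l<1+i)) , last<

  ≈-last : ∀ {i a b} → a ≈[ i ] b → a (suc i) ≡ b (suc i) → a ≈[ suc i ] b
  ≈-last {i} a≈b last≡ l l≤1+i with m≤n⇒m<n∨m≡n l≤1+i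
  ... | inj₁ l<1+i = a≈b l (≤-pred l<1+i)
  ... | inj₂ refl  = last≡

  lex-split : ∀ {i a b} → a <[ suc i ] b → a <[ i ] b ⊎ (a ≈[ i ] b × a (suc i) ≺ b (suc i))
  lex-split (j , j≤1+i , a≈b , aj<bj) with m≤n⇒m<n∨m≡n j≤1+i
  ... | inj₁ j<1+i = inj₁ (j , ≤-pred j<1+i , a≈b , aj<bj)
  ... | inj₂ refl  = inj₂ ((λ l l≤i → a≈b l (s≤s l≤i)) , aj<bj)

  lex-cmp : ∀ i a b → a <[ i ] b ⊎ b <[ i ] a ⊎ a ≈[ i ] b
  lex-cmp zero a b with compare (a 0) (b 0)
  ... | tri< a0<b0 _ _ = inj₁ (0 , z≤n , (λ _ ()) , a0<b0)
  ... | tri≈ _ a0≡b0 _ = inj₂ (inj₂ λ { zero z≤n → a0≡b0 })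
  ... | tri> _ _ b0<a0 = inj₂ (inj₁ (0 , z≤n , (λ _ ()) , b0<a0))
  lex-cmp (suc i) a b with lex-cmp i a b
  ... | inj₁ a<b        = inj₁ (lex-weaken a<b)
  ... | inj₂ (inj₁ b<a) = inj₂ (inj₁ (lex-weaken b<a))
  ... | inj₂ (inj₂ a≈b) with compare (a (suc i)) (b (suc i))
  ...   | tri< last< _ _ = inj₁ (lex-last a≈b last<)
  ...   | tri≈ _ last≡ _ = inj₂ (inj₂ (≈-last a≈b last≡))
  ...   | tri> _ _ last> = inj₂ (inj₁ (lex-last (≈-sym a≈b) last>))

Frequently : (ℕ → Set) → Set
Frequently P = ∀ N → ∃ λ i → N ≤ i × P i

below-suc : ∀ {B} {P : ℕ → Set} → (∃ λ c → c < suc B × P c) → (∃ λ c → c < B × P c) ⊎ P B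
below-suc (c , c<1+B , Pc) with m≤n⇒m<n∨m≡n (≤-pred c<1+B)
... | inj₁ c<B  = inj₁ (c , c<B , Pc)
... | inj₂ refl = inj₂ Pc

module Classical (em : ExcludedMiddle 0ℓ) where

  wf-minimal : ∀ {X : Set} {_≺_ : Rel X 0ℓ} → WellFounded _≺_ → (P : X → Set) → ∀ {x} → P x →
               ∃ λ m → P m × (∀ y → P y → ¬ (y ≺ m))
  wf-minimal {_≺_ = _≺_} wf P {x} px = go (wf x) px
    where
    go : ∀ {x} → Acc _≺_ x → P x → ∃ λ m → P m × (∀ y → P y → ¬ (y ≺ m))
    go {x} (acc rec) px with em {∃ λ y → P y × y ≺ x}
    ... | yes (y , py , y≺x) = go (rec y≺x) py
    ... | no  ∄smaller       = x , px , λ y py y≺x → ∄smaller (y , py , y≺x)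

  subsetOf : ∀ {n} → (Fin n → Set) → Subset n
  subsetOf P = tabulate λ x → isYes (em {P x})

  ∈-subsetOf⁻ : ∀ {n} {P : Fin n → Set} {x} → x ∈ subsetOf P → P x
  ∈-subsetOf⁻ {x = x} x∈P =
    toWitness (Equivalence.from T-≡ (trans (sym (lookup∘tabulate _ x)) ([]=⇒lookup x∈P)))

  ∈-subsetOf⁺ : ∀ {n} {P : Fin n → Set} {x} → P x → x ∈ subsetOf P
  ∈-subsetOf⁺ {x = x} px =
    lookup⇒[]= x _ (trans (lookup∘tabulate _ x) (Equivalence.to T-≡ (fromWitness px)))

  ¬frequently⇒finite : ∀ {P} → ¬ Frequently P → Often.Fin P
  ¬frequently⇒finite {P} ¬freq with em {Often.Fin P}
  ... | yes finite = finite
  ... | no ¬fin = ⊥-elim (¬freq frequently)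
    where
    frequently : Frequently P
    frequently N with em {∃ λ i → N ≤ i × P i}
    ... | yes later = later
    ... | no ¬later = ⊥-elim (¬fin (N , λ i N≤i Pi → ¬later (i , N≤i , Pi)))

  finitely-below : (C : ℕ → ℕ → Set) → ∀ B → (∀ c → c < B → ¬ Frequently (λ i → C i c)) →
                   Often.Fin (λ i → ∃ λ c → c < B × C i c)
  finitely-below C zero    _     = 0 , λ { _ _ (_ , () , _) }
  finitely-below C (suc B) ¬freq with finitely-below C B (λ c c<B → ¬freq c (m≤n⇒m≤1+n c<B))
                                      ∪-Fin ¬frequently⇒finite (¬freq B ≤-refl)
  ... | N , none = N , λ i N≤i → none i N≤i ∘ below-suc

  least-frequent : (C : ℕ → ℕ → Set) → ∀ B → Frequently (λ i → ∃ λ c → c ≤ B × C i c) →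
    ∃ λ c → c ≤ B × Frequently (λ i → C i c) × (∀ c′ → c′ < c → ¬ Frequently (λ i → C i c′))
  least-frequent C B freq with em {∃ λ c → c ≤ B × Frequently (λ i → C i c)}
  ... | yes (c , c≤B , freq-c) with wf-minimal <-wellFounded (λ c → Frequently (λ i → C i c)) freq-c
  ...   | m , freq-m , m-least =
          m , ≤-trans (≮⇒≥ λ c<m → m-least c freq-c c<m) c≤B , freq-m ,
          λ c′ c′<m freq-c′ → m-least c′ freq-c′ c′<m
  least-frequent C B freq | no ∄c
    with finitely-below C (suc B) (λ c c<1+B freq-c → ∄c (c , ≤-pred c<1+B , freq-c))
  ... | N , none with freq N
  ...   | i , N≤i , c , c≤B , Cic = ⊥-elim (none i N≤i (c , s≤s c≤B , Cic))

  nonincreasing⇒eventually-constant : (a : ℕ → ℕ) → ∀ t → (∀ {i j} → t ≤ i → i ≤ j → a j ≤ a i) →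
    ∃ λ T → t ≤ T × ∀ j → T ≤ j → a j ≡ a T
  nonincreasing⇒eventually-constant a t antitone
    with wf-minimal <-wellFounded (λ v → ∃ λ i → t ≤ i × a i ≡ v) (t , ≤-refl , refl)
  ... | _ , (T , t≤T , refl) , least =
    T , t≤T , λ j T≤j → ≤-antisym (antitone t≤T T≤j)
                                   (≮⇒≥ λ aj<aT → least (a j) (j , ≤-trans t≤T T≤j , refl) aj<aT)

from-induction : ∀ {P : ℕ → Set} {i₀} → P i₀ → (∀ j → i₀ ≤ j → P j → P (suc j)) → ∀ j → i₀ ≤ j → P j
from-induction base step zero    z≤n = base
from-induction base step (suc j) i₀≤1+j with m≤n⇒m<n∨m≡n i₀≤1+j
... | inj₁ i₀<1+j = step j (≤-pred i₀<1+j) (from-induction base step j (≤-pred i₀<1+j))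
... | inj₂ refl   = base

extend : ∀ {X : Set} → ℕ → (ℕ → X) → X → ℕ → X
extend i ρ x l with l ≤? i
... | yes _ = ρ l
... | no  _ = x

extend-≤ : ∀ {X : Set} {i l} (ρ : ℕ → X) x → l ≤ i → extend i ρ x l ≡ ρ l
extend-≤ {i = i} {l} ρ x l≤i with l ≤? i
... | yes _   = refl
... | no  l≰i = ⊥-elim (l≰i l≤i)

extend-last : ∀ {X : Set} i (ρ : ℕ → X) x → extend i ρ x (suc i) ≡ x
extend-last i ρ x with suc i ≤? i
... | yes 1+i≤i = ⊥-elim (<-irrefl refl 1+i≤i)
... | no  _     = refl

2*[1+t]∸1≡1+2*t : ∀ t → 2 * suc t ∸ 1 ≡ suc (2 * t)
2*[1+t]∸1≡1+2*t t = cong (_∸ 1) (*-suc 2 t)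

2*[1+t]∸1≤2*m⇒1+t≤m : ∀ t m → 2 * suc t ∸ 1 ≤ 2 * m → suc t ≤ m
2*[1+t]∸1≤2*m⇒1+t≤m t m le = *-cancelˡ-< 2 t m (subst (_≤ 2 * m) (2*[1+t]∸1≡1+2*t t) le)

1+t≤m⇒2*[1+t]∸1<2*m : ∀ t m → suc t ≤ m → 2 * suc t ∸ 1 < 2 * m
1+t≤m⇒2*[1+t]∸1<2*m t m le =
  subst (_< 2 * m) (sym (2*[1+t]∸1≡1+2*t t)) (subst (_≤ 2 * m) (*-suc 2 t) (*-monoʳ-≤ 2 le))

module LimitDeterministic (em : ExcludedMiddle 0ℓ) {n k : ℕ} (A : Buchi n k) (Qd : Subset n)
                          (ldba : IsLDBA A Qd) (Ord : Fin n → ℕ∞) (isOrd : IsOrdering Qd Ord)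
                          (w : Word k) where
  open Buchi A
  open IsLDBA ldba
  open IsOrdering isOrd renaming (outside to Ord-outside)
  open RunDAG A Qd Ord w
  open Classical em
  open Lexicographic <∞-isStrictTotalOrder

  ∈Qd⇒Ord≢∞ : ∀ {q} → q ∈ Qd → Ord q ≢ ∞
  ∈Qd⇒Ord≢∞ {q} q∈Qd Ord≡∞ with inRange q q∈Qd
  ... | _ , Ord≡fin , _ with trans (sym Ord≡fin) Ord≡∞
  ... | ()

  Ord≢∞⇒∈Qd : ∀ {q} → Ord q ≢ ∞ → q ∈ Qd
  Ord≢∞⇒∈Qd {q} Ord≢∞ with q ∈? Qd
  ... | yes q∈Qd = q∈Qd
  ... | no  q∉Qd = ⊥-elim (Ord≢∞ (Ord-outside q q∉Qd))

  Ord-injective : ∀ {q q′} → q ∈ Qd → Ord q ≡ Ord q′ → q ≡ q′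
  Ord-injective q∈Qd eq = injQd _ _ q∈Qd (Ord≢∞⇒∈Qd λ q′≡∞ → ∈Qd⇒Ord≢∞ q∈Qd (trans eq q′≡∞)) eq

  Edge : ℕ → Fin n → Fin n → Set
  Edge i q q′ = T (δ q (w i) q′)

  next : ℕ → Fin n → Fin n
  next i q = proj₁ (total q (w i))

  Edge-next : ∀ {i q} → Edge i q (next i q)
  Edge-next {i} {q} = proj₂ (total q (w i))

  Edge⇒≡next : ∀ {i q q′} → q ∈ Qd → Edge i q q′ → q′ ≡ next i q
  Edge⇒≡next {i} {q} {q′} q∈Qd q→q′ = det q (w i) q′ (next i q) q∈Qd q→q′ Edge-next

  trapped : ∀ (ρ : ℕ → Fin n) {i j} → (∀ l → l < i → Edge l (ρ l) (ρ (suc l))) → j ≤ i → ρ j ∈ Qd → ρ i ∈ Qd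
  trapped ρ {zero}  edges z≤n ρj∈Qd = ρj∈Qd
  trapped ρ {suc i} edges j≤1+i ρj∈Qd with m≤n⇒m<n∨m≡n j≤1+i
  ... | inj₁ j<1+i = closed (ρ i) (w i) (ρ (suc i))
                       (trapped ρ {i} (λ l l<i → edges l (m<n⇒m<1+n l<i)) (≤-pred j<1+i) ρj∈Qd) (edges i ≤-refl)
  ... | inj₂ refl  = ρj∈Qd

  PrefixTo : ℕ → Fin n → (ℕ → Fin n) → Set
  PrefixTo i q ρ = IsPrefix i ρ × ρ i ≡ q

  IsPrefix-shorten : ∀ {i ρ} → IsPrefix (suc i) ρ → IsPrefix i ρ
  IsPrefix-shorten (ρ₀ , edges) = ρ₀ , λ j j<i → edges j (m<n⇒m<1+n j<i)

  IsPrefix-extend : ∀ {i ρ q} → IsPrefix i ρ → Edge i (ρ i) q → PrefixTo (suc i) q (extend i ρ q)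
  IsPrefix-extend {i} {ρ} {q} (ρ₀ , edges) ρi→q =
    (trans (extend-≤ ρ q (z≤n {i})) ρ₀ , edges′) , extend-last i ρ q
    where
    edges′ : ∀ j → j < suc i → Edge j (extend i ρ q j) (extend i ρ q (suc j))
    edges′ j j<1+i with m≤n⇒m<n∨m≡n (≤-pred j<1+i)
    ... | inj₁ j<i rewrite extend-≤ ρ q (<⇒≤ j<i) | extend-≤ ρ q j<i = edges j j<i
    ... | inj₂ refl rewrite extend-≤ ρ q (≤-refl {i}) | extend-last i ρ q = ρi→q

  Ord-extend : ∀ i ρ q → Ord ∘ extend i ρ q ≈[ i ] Ord ∘ ρ
  Ord-extend i ρ q l l≤i = cong Ord (extend-≤ ρ q l≤i)

  InV⇒prefix : ∀ {i q} → InV i q → ∃ (PrefixTo i q)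
  InV⇒prefix base = (λ _ → q₀) , (refl , λ _ ()) , refl
  InV⇒prefix (step {i} {q′} {q} q′∈V q′→q) with InV⇒prefix q′∈V
  ... | ρ , ρ-prefix , refl = extend i ρ q , IsPrefix-extend ρ-prefix q′→q

  IsPrefix⇒InV : ∀ i {ρ} → IsPrefix i ρ → InV i (ρ i)
  IsPrefix⇒InV zero    (ρ₀ , _)    = subst (InV 0) (sym ρ₀) base
  IsPrefix⇒InV (suc i) ρ-prefix = step (IsPrefix⇒InV i (IsPrefix-shorten ρ-prefix)) (proj₂ ρ-prefix i ≤-refl)

  ⊏-irrefl : ∀ {i q} → ¬ (q ⊏[ i ] q)
  ⊏-irrefl (q≢q , _) = q≢q refl

  ⊏-trans : ∀ {i x y z} → x ⊏[ i ] y → y ⊏[ i ] z → x ⊏[ i ] z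
  ⊏-trans {i} {x} {z = z} (_ , ρx , ρx-prefix , ρx-end , ρx-least) (_ , ρy , ρy-prefix , ρy-end , ρy-least) =
    x≢z , ρx , ρx-prefix , ρx-end , λ τ τ-prefix τ-end → lex-trans ρx<ρy (ρy-least τ τ-prefix τ-end)
    where
    ρx<ρy : Ord ∘ ρx <[ i ] Ord ∘ ρy
    ρx<ρy = ρx-least ρy ρy-prefix ρy-end
    x≢z : x ≢ z
    x≢z refl = lex-irrefl (lex-trans ρx<ρy (ρy-least ρx ρx-prefix ρx-end))

  lex-minimal : (P : (ℕ → Fin n) → Set) → ∀ i → ∃ P →
                ∃ λ ρ → P ρ × (∀ τ → P τ → ¬ (Ord ∘ τ <[ i ] Ord ∘ ρ))
  lex-minimal P zero (_ , Pρ₀) with wf-minimal (On.wellFounded (λ ρ → Ord (ρ 0)) <∞-wellFounded) P Pρ₀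
  ... | ρ , Pρ , least = ρ , Pρ , λ { τ Pτ (j , j≤0 , _ , τj<ρj) →
          least τ Pτ (subst (λ j → Ord (τ j) <∞ Ord (ρ j)) (n≤0⇒n≡0 j≤0) τj<ρj) }
  lex-minimal P (suc i) ∃P with lex-minimal P i ∃P
  ... | ρ₀ , Pρ₀ , least₀
    with wf-minimal (On.wellFounded (λ ρ → Ord (ρ (suc i))) <∞-wellFounded)
                    (λ τ → P τ × Ord ∘ τ ≈[ i ] Ord ∘ ρ₀) (Pρ₀ , λ _ _ → refl)
  ...   | ρ , (Pρ , ρ≈ρ₀) , least = ρ , Pρ , not-below
    where
    not-below : ∀ τ → P τ → ¬ (Ord ∘ τ <[ suc i ] Ord ∘ ρ)
    not-below τ Pτ τ<ρ with lex-split τ<ρ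
    ... | inj₁ τ<ρ         = least₀ τ Pτ (lex-respʳ-≈ τ<ρ ρ≈ρ₀)
    ... | inj₂ (τ≈ρ , last<) = least τ (Pτ , ≈-trans τ≈ρ ρ≈ρ₀) last<

  lex-below-minimal : ∀ {i y ρ ρy} → (∀ τ → PrefixTo i y τ → ¬ (Ord ∘ τ <[ i ] Ord ∘ ρy)) →
                      Ord ∘ ρ <[ i ] Ord ∘ ρy → ∀ τ → IsPrefix i τ → τ i ≡ y → Ord ∘ ρ <[ i ] Ord ∘ τ
  lex-below-minimal {i} {ρy = ρy} ρy-least ρ<ρy τ τ-prefix τ-end with lex-cmp i (Ord ∘ ρy) (Ord ∘ τ)
  ... | inj₁ ρy<τ        = lex-trans ρ<ρy ρy<τ
  ... | inj₂ (inj₁ τ<ρy) = ⊥-elim (ρy-least τ (τ-prefix , τ-end) τ<ρy)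
  ... | inj₂ (inj₂ ρy≈τ) = lex-respʳ-≈ ρ<ρy ρy≈τ

  ⊏-total : ∀ {i x y} → InVd i x → InVd i y → x ≢ y → x ⊏[ i ] y ⊎ y ⊏[ i ] x
  ⊏-total {i} {x} {y} (x∈V , x∈Qd) (y∈V , _) x≢y
    with lex-minimal (PrefixTo i x) i (InV⇒prefix x∈V) | lex-minimal (PrefixTo i y) i (InV⇒prefix y∈V)
  ... | ρx , (ρx-prefix , ρx-end) , ρx-least | ρy , (ρy-prefix , ρy-end) , ρy-least
    with lex-cmp i (Ord ∘ ρx) (Ord ∘ ρy)
  ... | inj₁ ρx<ρy        = inj₁ (x≢y , ρx , ρx-prefix , ρx-end , lex-below-minimal ρy-least ρx<ρy)
  ... | inj₂ (inj₁ ρy<ρx) = inj₂ (x≢y ∘ sym , ρy , ρy-prefix , ρy-end , lex-below-minimal ρx-least ρy<ρx)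
  ... | inj₂ (inj₂ ρx≈ρy) =
    ⊥-elim (x≢y (Ord-injective x∈Qd
      (trans (cong Ord (sym ρx-end)) (trans (ρx≈ρy i ≤-refl) (cong Ord ρy-end)))))

  -- u is the state at time i of the prefix witnessing u′ ⊏ v′.
  ⊏-predecessor : ∀ {i u′ v′ v} → u′ ⊏[ suc i ] v′ → InVd i v → Edge i v v′ →
                  ∃ λ u → InVd i u × Edge i u u′ × u ⊏[ i ] v
  ⊏-predecessor {i} {u′} {v′} {v} (u′≢v′ , ρ , ρ-prefix , ρ-end , ρ-least) (v∈V , v∈Qd) v→v′ =
    ρ i , (IsPrefix⇒InV i ρ-prefix′ , ρi∈Qd) , ρi→u′ , ρi≢v , ρ , ρ-prefix′ , refl , ρ-below
    where
    ρ-prefix′ : IsPrefix i ρ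
    ρ-prefix′ = IsPrefix-shorten ρ-prefix
    ρi→u′ : Edge i (ρ i) u′
    ρi→u′ = subst (Edge i (ρ i)) ρ-end (proj₂ ρ-prefix i ≤-refl)
    below-or-tied : ∀ τ → PrefixTo i v τ → Ord ∘ ρ <[ i ] Ord ∘ τ ⊎ Ord (ρ i) ≡ Ord v
    below-or-tied τ (τ-prefix , refl)
      with lex-split (uncurry (ρ-least (extend i τ v′)) (IsPrefix-extend τ-prefix v→v′))
    ... | inj₁ ρ<τ′        = inj₁ (lex-respʳ-≈ ρ<τ′ (Ord-extend i τ v′))
    ... | inj₂ (ρ≈τ′ , _) = inj₂ (trans (ρ≈τ′ i ≤-refl) (Ord-extend i τ v′ i ≤-refl))
    ρi∈Qd : ρ i ∈ Qd
    ρi∈Qd with InV⇒prefix v∈V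
    ... | τ , τ-to-v with below-or-tied τ τ-to-v
    ...   | inj₁ (j , j≤i , _ , ρj<τj) = trapped ρ (proj₂ ρ-prefix′) j≤i (Ord≢∞⇒∈Qd (<∞⇒≢∞ ρj<τj))
    ...   | inj₂ ρi≡v = Ord≢∞⇒∈Qd λ ρi≡∞ → ∈Qd⇒Ord≢∞ v∈Qd (trans (sym ρi≡v) ρi≡∞)
    ρi≢v : ρ i ≢ v
    ρi≢v refl = u′≢v′ (det v (w i) u′ v′ ρi∈Qd ρi→u′ v→v′)
    ρ-below : ∀ τ → IsPrefix i τ → τ i ≡ v → Ord ∘ ρ <[ i ] Ord ∘ τ
    ρ-below τ τ-prefix τ-end with below-or-tied τ (τ-prefix , τ-end)
    ... | inj₁ ρ<τ   = ρ<τ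
    ... | inj₂ ρi≡v = ⊥-elim (ρi≢v (Ord-injective ρi∈Qd ρi≡v))

  below : ℕ → Fin n → Subset n
  below i q = subsetOf λ u → InVd i u × u ⊏[ i ] q

  index : ℕ → Fin n → ℕ
  index i q = suc ∣ below i q ∣

  below⁻ : ∀ {i q u} → u ∈ below i q → InVd i u × u ⊏[ i ] q
  below⁻ = ∈-subsetOf⁻

  below⁺ : ∀ {i q u} → InVd i u → u ⊏[ i ] q → u ∈ below i q
  below⁺ u∈Vd u⊏q = ∈-subsetOf⁺ (u∈Vd , u⊏q)

  below⇒InVd : ∀ {i q u} → u ∈ below i q → InVd i u
  below⇒InVd = proj₁ ∘ below⁻

  below⇒⊏ : ∀ {i q u} → u ∈ below i q → u ⊏[ i ] q
  below⇒⊏ = proj₂ ∘ below⁻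

  index-Ind : ∀ {i q} → InVd i q → Ind i q (index i q)
  index-Ind {i} {q} q∈Vd = q∈Vd , below i q , (λ _ → below⁻) , (λ _ → below⁺) , refl

  Ind⇒≡index : ∀ {i q j} → Ind i q j → j ≡ index i q
  Ind⇒≡index (_ , S , S⊆below , below⊆S , refl) =
    cong (λ S → suc ∣ S ∣) (⊆-antisym (λ u∈S → uncurry below⁺ (S⊆below _ u∈S))
                                      (λ u∈below → uncurry (below⊆S _) (below⁻ u∈below)))

  index-mono : ∀ {i x y} → InVd i x → x ⊏[ i ] y → index i x < index i y
  index-mono {i} {x} {y} x∈Vd x⊏y = s≤s (p⊂q⇒∣p∣<∣q∣ (below-mono , x , below⁺ x∈Vd x⊏y , ⊏-irrefl ∘ below⇒⊏))
    where
    below-mono : below i x ⊆ below i y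
    below-mono u∈below = below⁺ (below⇒InVd u∈below) (⊏-trans (below⇒⊏ u∈below) x⊏y)

  index-injective : ∀ {i x y} → InVd i x → InVd i y → index i x ≡ index i y → x ≡ y
  index-injective {x = x} {y} x∈Vd y∈Vd eq with x ≟ y
  ... | yes x≡y = x≡y
  ... | no  x≢y with ⊏-total x∈Vd y∈Vd x≢y
  ...   | inj₁ x⊏y = ⊥-elim (<-irrefl eq (index-mono x∈Vd x⊏y))
  ...   | inj₂ y⊏x = ⊥-elim (<-irrefl (sym eq) (index-mono y∈Vd y⊏x))

  index≤∣Qd∣ : ∀ {i q} → InVd i q → index i q ≤ ∣ Qd ∣
  index≤∣Qd∣ (_ , q∈Qd) = p⊂q⇒∣p∣<∣q∣ (proj₂ ∘ below⇒InVd , _ , q∈Qd , ⊏-irrefl ∘ below⇒⊏)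

  InVd-next : ∀ {i q} → InVd i q → InVd (suc i) (next i q)
  InVd-next {i} {q} (q∈V , q∈Qd) = step q∈V Edge-next , closed q (w i) (next i q) q∈Qd Edge-next

  Edge-unique : ∀ {i u y y′} → InVd i u → Edge i u y → Edge i u y′ → y ≡ y′
  Edge-unique {i} {u} {y} {y′} (_ , u∈Qd) = det u (w i) y y′ u∈Qd

  below-predecessor : ∀ {i v v′ y} → InVd i v → Edge i v v′ → y ∈ below (suc i) v′ →
                      ∃ λ u → u ∈ below i v × Edge i u y
  below-predecessor v∈Vd v→v′ y∈below with ⊏-predecessor (below⇒⊏ y∈below) v∈Vd v→v′
  ... | u , u∈Vd , u→y , u⊏v = u , below⁺ u∈Vd u⊏v , u→y

  index-antitone : ∀ {i v v′} → InVd i v → Edge i v v′ → index (suc i) v′ ≤ index i v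
  index-antitone v∈Vd v→v′ = s≤s (matching⇒∣p∣≤∣q∣ (below-predecessor v∈Vd v→v′)
    λ _ _ u∈below → Edge-unique (below⇒InVd u∈below))

  Dec⇒index-drops : ∀ {i q} → InDec i q → index (suc i) (next i q) < index i q
  Dec⇒index-drops (q∈Vd , q′ , q→q′ , _ , j , j′ , Ind-j , Ind-j′ , j′<j)
    rewrite Ind⇒≡index Ind-j | Ind⇒≡index Ind-j′ | Edge⇒≡next (proj₂ q∈Vd) q→q′ = j′<j

  -- Since ∣ below (suc i) r′ ∣ = ∣ below i r ∣, next maps below i r injectively and order-preservingly into
  -- below (suc i) r′; so nodes below r cannot decrease, and neither can r.
  module IndexKept {i r r′} (r∈Vd : InVd i r) (r→r′ : Edge i r r′) (kept : index (suc i) r′ ≡ index i r) where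

    next-injective : ∀ {x₁ x₂} → x₁ ∈ below i r → x₂ ∈ below i r → next i x₁ ≡ next i x₂ → x₁ ≡ x₂
    next-injective {x₁} {x₂} x₁∈below x₂∈below next≡ with x₁ ≟ x₂
    ... | yes x₁≡x₂ = x₁≡x₂
    ... | no  x₁≢x₂ = ⊥-elim (<-irrefl refl (begin-strict
          index (suc i) r′     ≤⟨ s≤s (matching⇒∣p∣≤∣q∣ predecessor-≢x₁ unique) ⟩
          suc ∣ below i r - x₁ ∣ <⟨ s≤s (x∈p⇒∣p-x∣<∣p∣ x₁∈below) ⟩
          index i r            ≡⟨ sym kept ⟩
          index (suc i) r′     ∎))
      where
      open ≤-Reasoning
      -- x₁ can be dropped from the predecessors: its only successor also has the predecessor x₂.
      predecessor-≢x₁ : ∀ {y} → y ∈ below (suc i) r′ → ∃ λ u → u ∈ below i r - x₁ × Edge i u y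
      predecessor-≢x₁ {y} y∈below with below-predecessor r∈Vd r→r′ y∈below
      ... | u , u∈below , u→y with u ≟ x₁
      ...   | no  u≢x₁ = u , x∈p∧x≢y⇒x∈p-y u∈below u≢x₁ , u→y
      ...   | yes refl = x₂ , x∈p∧x≢y⇒x∈p-y x₂∈below (x₁≢x₂ ∘ sym) ,
                         subst (Edge i x₂) (sym (trans (Edge⇒≡next (proj₂ (below⇒InVd x₁∈below)) u→y) next≡))
                               Edge-next
      unique : ∀ {y y′ u} → y ∈ below (suc i) r′ → y′ ∈ below (suc i) r′ → u ∈ below i r - x₁ →
               Edge i u y → Edge i u y′ → y ≡ y′
      unique _ _ u∈below = Edge-unique (below⇒InVd (p─q⊆p _ _ u∈below))

    next-⊏-mono : ∀ {z u} → z ∈ below i r → u ∈ below i r → z ⊏[ i ] u → next i z ⊏[ suc i ] next i u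
    next-⊏-mono {z} {u} z∈below u∈below z⊏u
      with ⊏-total (InVd-next (below⇒InVd z∈below)) (InVd-next (below⇒InVd u∈below))
                   (proj₁ z⊏u ∘ next-injective z∈below u∈below)
    ... | inj₁ nz⊏nu = nz⊏nu
    ... | inj₂ nu⊏nz with ⊏-predecessor nu⊏nz (below⇒InVd z∈below) Edge-next
    ...   | p , p∈Vd , p→nu , p⊏z = ⊥-elim (⊏-irrefl (⊏-trans z⊏u (subst (_⊏[ i ] z) p≡u p⊏z)))
      where
      p≡u : p ≡ u
      p≡u = next-injective (below⁺ p∈Vd (⊏-trans p⊏z (below⇒⊏ z∈below))) u∈below
                           (sym (Edge⇒≡next (proj₂ p∈Vd) p→nu))

    index≤index-next : ∀ {u} → u ∈ below i r → index i u ≤ index (suc i) (next i u)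
    index≤index-next {u} u∈below = s≤s (matching⇒∣p∣≤∣q∣ image unique)
      where
      below-u⊆below-r : ∀ {z} → z ∈ below i u → z ∈ below i r
      below-u⊆below-r z∈below = below⁺ (below⇒InVd z∈below) (⊏-trans (below⇒⊏ z∈below) (below⇒⊏ u∈below))
      image : ∀ {z} → z ∈ below i u → ∃ λ y → y ∈ below (suc i) (next i u) × next i z ≡ y
      image z∈below = _ , below⁺ (InVd-next (below⇒InVd z∈below))
                                 (next-⊏-mono (below-u⊆below-r z∈below) u∈below (below⇒⊏ z∈below)) , refl
      unique : ∀ {z z′ y} → z ∈ below i u → z′ ∈ below i u → y ∈ below (suc i) (next i u) →
               next i z ≡ y → next i z′ ≡ y → z ≡ z′
      unique z∈below z′∈below _ nz≡y nz′≡y =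
        next-injective (below-u⊆below-r z∈below) (below-u⊆below-r z′∈below) (trans nz≡y (sym nz′≡y))

    no-Dec : ∀ {q} → InDec i q → index i q ≤ index i r → ⊥
    no-Dec {q} q∈Dec q≤r with q ≟ r
    ... | yes refl =
      <-irrefl (trans (cong (index (suc i)) (sym (Edge⇒≡next (proj₂ r∈Vd) r→r′))) kept) (Dec⇒index-drops q∈Dec)
    ... | no  q≢r with ⊏-total (proj₁ q∈Dec) r∈Vd q≢r
    ...   | inj₁ q⊏r =
      <-irrefl refl (<-≤-trans (Dec⇒index-drops q∈Dec) (index≤index-next (below⁺ (proj₁ q∈Dec) q⊏r)))
    ...   | inj₂ r⊏q = <-irrefl refl (<-≤-trans (index-mono r∈Vd r⊏q) q≤r)

  minimal-index : ∀ {i} (P : Fin n → Set) → (∀ {q} → P q → InVd i q) → ∃ P → ∃ (MinInd i P)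
  minimal-index {i} P P⇒Vd (q , Pq)
    with wf-minimal <-wellFounded (λ m → ∃ λ q → P q × Ind i q m) (q , Pq , index-Ind (P⇒Vd Pq))
  ... | m , witness , least = m , witness , λ q j Pq Ind-j → ≮⇒≥ λ j<m → least j (q , Pq , Ind-j) j<m

  min-Acc : ∀ {i} → ∃ (InAcc i) → ∃ (MinInd i (InAcc i))
  min-Acc = minimal-index _ proj₁

  min-Dec : ∀ {i} → ∃ (InDec i) → ∃ (MinInd i (InDec i))
  min-Dec = minimal-index _ proj₁

  colour-exists : ∀ i → ∃ (Color i)
  colour-exists i with em {∃ (InDec i)} | em {∃ (InAcc i)}
  ... | no ∄dec | no ∄acc = _ , inj₁ (curry ∄dec , curry ∄acc , refl)
  ... | no ∄dec  | yes ∃acc = _ , inj₂ (inj₁ (curry ∄dec , _ , proj₂ (min-Acc ∃acc) , refl))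
  ... | yes ∃dec | no ∄acc  = _ , inj₂ (inj₂ (inj₁ (curry ∄acc , _ , proj₂ (min-Dec ∃dec) , refl)))
  ... | yes ∃dec | yes ∃acc = _ , inj₂ (inj₂ (inj₂ (_ , _ , proj₂ (min-Acc ∃acc) , proj₂ (min-Dec ∃dec) , refl)))

  colour≤Acc : ∀ {i c q} → Color i c → InAcc i q → c ≤ 2 * index i q
  colour≤Acc (inj₁ (_ , ∄acc , _)) q∈Acc = ⊥-elim (∄acc _ q∈Acc)
  colour≤Acc (inj₂ (inj₁ (_ , _ , (_ , least) , refl))) q∈Acc =
    *-monoʳ-≤ 2 (least _ _ q∈Acc (index-Ind (proj₁ q∈Acc)))
  colour≤Acc (inj₂ (inj₂ (inj₁ (∄acc , _)))) q∈Acc = ⊥-elim (∄acc _ q∈Acc)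
  colour≤Acc (inj₂ (inj₂ (inj₂ (m , _ , (_ , least) , _ , refl)))) q∈Acc =
    ≤-trans (m⊓n≤m (2 * m) _) (*-monoʳ-≤ 2 (least _ _ q∈Acc (index-Ind (proj₁ q∈Acc))))

  colour≤Dec : ∀ {i c q} → Color i c → InDec i q → c ≤ 2 * index i q ∸ 1
  colour≤Dec (inj₁ (∄dec , _)) q∈Dec = ⊥-elim (∄dec _ q∈Dec)
  colour≤Dec (inj₂ (inj₁ (∄dec , _))) q∈Dec = ⊥-elim (∄dec _ q∈Dec)
  colour≤Dec (inj₂ (inj₂ (inj₁ (_ , _ , (_ , least) , refl)))) q∈Dec =
    ∸-monoˡ-≤ 1 (*-monoʳ-≤ 2 (least _ _ q∈Dec (index-Ind (proj₁ q∈Dec))))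
  colour≤Dec (inj₂ (inj₂ (inj₂ (_ , m′ , _ , (_ , least) , refl)))) q∈Dec =
    ≤-trans (m⊓n≤n _ (2 * m′ ∸ 1)) (∸-monoˡ-≤ 1 (*-monoʳ-≤ 2 (least _ _ q∈Dec (index-Ind (proj₁ q∈Dec)))))

  even≢2*index∸1 : ∀ {i q} m → 2 * m ≢ 2 * index i q ∸ 1
  even≢2*index∸1 {i} {q} m eq = even≢odd m ∣ below i q ∣ (trans eq (2*[1+t]∸1≡1+2*t ∣ below i q ∣))

  odd-colour⇒Dec : ∀ {i c} → Color i c → ¬ 2 ∣ c → c ≤ 2 * ∣ Qd ∣ → ∃ λ q → InDec i q × 2 * index i q ∸ 1 ≡ c
  odd-colour⇒Dec (inj₁ (_ , _ , refl)) _ c≤ = ⊥-elim (1+n≰n (subst (_≤ 2 * ∣ Qd ∣) (+-comm (2 * ∣ Qd ∣) 1) c≤))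
  odd-colour⇒Dec (inj₂ (inj₁ (_ , m , _ , refl))) odd _ = ⊥-elim (odd (divides m (*-comm 2 m)))
  odd-colour⇒Dec (inj₂ (inj₂ (inj₁ (_ , _ , ((q , q∈Dec , Ind-q) , _) , refl)))) _ _ =
    q , q∈Dec , cong (λ j → 2 * j ∸ 1) (sym (Ind⇒≡index Ind-q))
  odd-colour⇒Dec (inj₂ (inj₂ (inj₂ (m , m′ , _ , ((q , q∈Dec , Ind-q) , _) , refl)))) odd _
    with ⊓-sel (2 * m) (2 * m′ ∸ 1)
  ... | inj₁ min≡2m = ⊥-elim (odd (divides m (trans min≡2m (*-comm 2 m))))
  ... | inj₂ min≡odd = q , q∈Dec , trans (cong (λ j → 2 * j ∸ 1) (sym (Ind⇒≡index Ind-q))) (sym min≡odd)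

  even-colour⇒Acc : ∀ {i m} → Color i (2 * m) → ∃ λ q → InAcc i q × index i q ≡ m
  even-colour⇒Acc {m = m} (inj₁ (_ , _ , eq)) = ⊥-elim (even≢odd m ∣ Qd ∣ (trans eq (+-comm (2 * ∣ Qd ∣) 1)))
  even-colour⇒Acc {m = m} (inj₂ (inj₁ (_ , m′ , ((q , q∈Acc , Ind-q) , _) , eq))) =
    q , q∈Acc , trans (sym (Ind⇒≡index Ind-q)) (sym (*-cancelˡ-≡ m m′ 2 eq))
  even-colour⇒Acc {m = m} (inj₂ (inj₂ (inj₁ (_ , _ , ((q , _ , Ind-q) , _) , eq)))) =
    ⊥-elim (even≢2*index∸1 m (trans eq (cong (λ j → 2 * j ∸ 1) (Ind⇒≡index Ind-q))))
  even-colour⇒Acc {m = m} (inj₂ (inj₂ (inj₂ (ma , m′ , ((q , q∈Acc , Ind-q) , _) , ((q′ , _ , Ind-q′) , _) , eq))))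
    with ⊓-sel (2 * ma) (2 * m′ ∸ 1)
  ... | inj₁ min≡2ma = q , q∈Acc , trans (sym (Ind⇒≡index Ind-q)) (sym (*-cancelˡ-≡ m ma 2 (trans eq min≡2ma)))
  ... | inj₂ min≡odd =
    ⊥-elim (even≢2*index∸1 m (trans (trans eq min≡odd) (cong (λ j → 2 * j ∸ 1) (Ind⇒≡index Ind-q′))))

  module Backward (ρ : ℕ → Fin n) (ρ-run : IsRun A w ρ)
                  (ρ-acc : Frequently λ i → T (α (ρ i) (w i) (ρ (suc i)))) where

    ρ-edges : ∀ i → Edge i (ρ i) (ρ (suc i))
    ρ-edges = proj₂ ρ-run

    trap-time : ℕ
    trap-time = proj₁ (ρ-acc 0)

    ρ-InVd : ∀ i → trap-time ≤ i → InVd i (ρ i)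
    ρ-InVd i t≤i = IsPrefix⇒InV i (proj₁ ρ-run , λ j _ → ρ-edges j) ,
                   trapped ρ (λ l _ → ρ-edges l) t≤i (proj₁ (accInQd _ _ _ (proj₂ (proj₂ (ρ-acc 0)))))

    rank : ℕ → ℕ
    rank i = index i (ρ i)

    rank-antitone : ∀ {i j} → trap-time ≤ i → i ≤ j → rank j ≤ rank i
    rank-antitone {i} {j} t≤i = from-induction {P = λ j → rank j ≤ rank i} ≤-refl one-step j
      where
      one-step : ∀ j → i ≤ j → rank j ≤ rank i → rank (suc j) ≤ rank i
      one-step j i≤j rank-j≤ = ≤-trans (index-antitone (ρ-InVd j (≤-trans t≤i i≤j)) (ρ-edges j)) rank-j≤

    module _ (T₀ : ℕ) (t≤T₀ : trap-time ≤ T₀) (constant : ∀ j → T₀ ≤ j → rank j ≡ rank T₀) where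

      m : ℕ
      m = rank T₀

      no-Dec-up-to-m : ∀ {i q} → T₀ ≤ i → InDec i q → index i q ≤ m → ⊥
      no-Dec-up-to-m {i} {q} T₀≤i q∈Dec q≤m =
        IndexKept.no-Dec (ρ-InVd i t≤i) (ρ-edges i)
          (trans (constant (suc i) (m≤n⇒m≤1+n T₀≤i)) (sym (constant i T₀≤i)))
          q∈Dec (subst (index i q ≤_) (sym (constant i T₀≤i)) q≤m)
        where
        t≤i : trap-time ≤ i
        t≤i = ≤-trans t≤T₀ T₀≤i

      frequently-≤2m : Frequently λ i → ∃ λ c → c ≤ 2 * m × Color i c
      frequently-≤2m N with ρ-acc (N ⊔ T₀)
      ... | i , N⊔T₀≤i , ρi→ρ1+i with colour-exists i
      ...   | c , colour = i , ≤-trans (m≤m⊔n N T₀) N⊔T₀≤i , c ,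
                           subst (λ r → c ≤ 2 * r) (constant i T₀≤i) (colour≤Acc colour ρi∈Acc) , colour
        where
        T₀≤i : T₀ ≤ i
        T₀≤i = ≤-trans (m≤n⊔m N T₀) N⊔T₀≤i
        t≤i : trap-time ≤ i
        t≤i = ≤-trans t≤T₀ T₀≤i
        ρi∈Acc : InAcc i (ρ i)
        ρi∈Acc = ρ-InVd i t≤i , ρ (suc i) , ρ-InVd (suc i) (m≤n⇒m≤1+n t≤i) , ρi→ρ1+i

      frequent-colour-even : ∀ {c} → c ≤ 2 * m → Frequently (λ i → Color i c) → 2 ∣ c
      frequent-colour-even {c} c≤2m freq-c with 2 ∣? c
      ... | yes even = even
      ... | no  odd with freq-c T₀
      ...   | i , T₀≤i , colour
        with odd-colour⇒Dec colour odd (≤-trans c≤2m (*-monoʳ-≤ 2 (index≤∣Qd∣ (ρ-InVd T₀ t≤T₀))))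
      ...     | q , q∈Dec , refl = ⊥-elim (no-Dec-up-to-m T₀≤i q∈Dec (2*[1+t]∸1≤2*m⇒1+t≤m _ m c≤2m))

      stable-summary-even : ColorSummaryEven
      stable-summary-even with least-frequent Color (2 * m) frequently-≤2m
      ... | c , c≤2m , freq-c , least = c , (freq-c , least) , frequent-colour-even c≤2m freq-c

    summary-even : ColorSummaryEven
    summary-even with nonincreasing⇒eventually-constant rank trap-time rank-antitone
    ... | T₀ , t≤T₀ , constant = stable-summary-even T₀ t≤T₀ constant

  module Forward (m : ℕ) (frequent : Frequently λ i → Color i (2 * m))
                 (least : ∀ c → c < 2 * m → ¬ Frequently λ i → Color i c) where

    quiet-time : ℕ
    quiet-time = proj₁ (finitely-below Color (2 * m) least)

    no-Dec-up-to-m : ∀ {i q} → quiet-time ≤ i → InDec i q → index i q ≤ m → ⊥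
    no-Dec-up-to-m {i} {q} N≤i q∈Dec q≤m with colour-exists i
    ... | c , colour = proj₂ (finitely-below Color (2 * m) least) i N≤i
          (c , ≤-<-trans (colour≤Dec colour q∈Dec) (1+t≤m⇒2*[1+t]∸1<2*m _ m q≤m) , colour)

    module _ {i₀ x₀} (N≤i₀ : quiet-time ≤ i₀) (x₀∈Acc : InAcc i₀ x₀) (x₀-index : index i₀ x₀ ≡ m)
             (π : ℕ → Fin n) (π-to-x₀ : PrefixTo i₀ x₀ π) where

      run : ℕ → Fin n
      run zero = π 0
      run (suc j) with suc j ≤? i₀
      ... | yes _ = π (suc j)
      ... | no  _ = next j (run j)

      run-≤ : ∀ {j} → j ≤ i₀ → run j ≡ π j
      run-≤ {zero} _ = refl
      run-≤ {suc j} 1+j≤i₀ with suc j ≤? i₀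
      ... | yes _     = refl
      ... | no  1+j≰i₀ = ⊥-elim (1+j≰i₀ 1+j≤i₀)

      run-> : ∀ {j} → i₀ ≤ j → run (suc j) ≡ next j (run j)
      run-> {j} i₀≤j with suc j ≤? i₀
      ... | yes 1+j≤i₀ = ⊥-elim (1+n≰n (≤-trans 1+j≤i₀ i₀≤j))
      ... | no  _      = refl

      run-edges : ∀ j → Edge j (run j) (run (suc j))
      run-edges j with suc j ≤? i₀
      ... | yes j<i₀ =
        subst (λ q → Edge j q (π (suc j))) (sym (run-≤ (<⇒≤ j<i₀))) (proj₂ (proj₁ π-to-x₀) j j<i₀)
      ... | no  _    = Edge-next

      -- A drop would put run j into Dec with index m.
      run-chain : ∀ j → i₀ ≤ j → InVd j (run j) × index j (run j) ≡ m
      run-chain = from-induction start one-step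
        where
        start : InVd i₀ (run i₀) × index i₀ (run i₀) ≡ m
        start rewrite run-≤ (≤-refl {i₀}) | proj₂ π-to-x₀ = proj₁ x₀∈Acc , x₀-index
        one-step : ∀ j → i₀ ≤ j → InVd j (run j) × index j (run j) ≡ m →
                   InVd (suc j) (run (suc j)) × index (suc j) (run (suc j)) ≡ m
        one-step j i₀≤j (run-j∈Vd , run-j-index) rewrite run-> i₀≤j
          with m≤n⇒m<n∨m≡n (index-antitone run-j∈Vd Edge-next)
        ... | inj₂ kept = InVd-next run-j∈Vd , trans kept run-j-index
        ... | inj₁ drop = ⊥-elim (no-Dec-up-to-m (≤-trans N≤i₀ i₀≤j) run-j∈Dec (≤-reflexive run-j-index))
          where
          run-j∈Dec : InDec j (run j)
          run-j∈Dec = run-j∈Vd , next j (run j) , Edge-next , InVd-next run-j∈Vd , _ , _ ,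
                      index-Ind run-j∈Vd , index-Ind (InVd-next run-j∈Vd) , drop

      run-accepting : Frequently λ j → T (α (run j) (w j) (run (suc j)))
      run-accepting N with frequent (N ⊔ i₀)
      ... | i , N⊔i₀≤i , colour with even-colour⇒Acc colour
      ...   | q , (q∈Vd , q′ , _ , q→q′) , q-index =
              i , ≤-trans (m≤m⊔n N i₀) N⊔i₀≤i , subst₂ (λ x y → T (α x (w i) y)) q≡run q′≡run q→q′
        where
        i₀≤i : i₀ ≤ i
        i₀≤i = ≤-trans (m≤n⊔m N i₀) N⊔i₀≤i
        q≡run : q ≡ run i
        q≡run = index-injective q∈Vd (proj₁ (run-chain i i₀≤i))
                                (trans q-index (sym (proj₂ (run-chain i i₀≤i))))
        q′≡run : q′ ≡ run (suc i)
        q′≡run = trans (Edge⇒≡next (proj₂ q∈Vd) (α⊆δ q (w i) q′ q→q′))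
                       (trans (cong (next i) q≡run) (sym (run-> i₀≤i)))

    accepts : Accepts A w
    accepts with frequent quiet-time
    ... | i₀ , N≤i₀ , colour with even-colour⇒Acc colour
    ...   | x₀ , x₀∈Acc , x₀-index with InV⇒prefix (proj₁ (proj₁ x₀∈Acc))
    ...     | π , π-to-x₀ = run N≤i₀ x₀∈Acc x₀-index π π-to-x₀ ,
                           (proj₁ (proj₁ π-to-x₀) , run-edges N≤i₀ x₀∈Acc x₀-index π π-to-x₀) ,
                           run-accepting N≤i₀ x₀∈Acc x₀-index π π-to-x₀

  summary-even⇒accepts : ColorSummaryEven → Accepts A w
  summary-even⇒accepts (_ , (frequent , least) , divides m refl) =
    Forward.accepts m (subst (λ c → Frequently λ i → Color i c) (*-comm m 2) frequent)
                      (λ c c<2m → least c (subst (c <_) (*-comm 2 m) c<2m))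

  accepts⇒summary-even : Accepts A w → ColorSummaryEven
  accepts⇒summary-even (ρ , ρ-run , ρ-acc) = Backward.summary-even ρ ρ-run ρ-acc

mainTheorem2 : ExcludedMiddle 0ℓ →
    ∀ {n k : ℕ} (A : Buchi n k) (Qd : Subset n) → IsLDBA A Qd →
    (Ord : Fin n → ℕ∞) → IsOrdering Qd Ord → (w : Word k) →
    RunDAG.ColorSummaryEven A Qd Ord w ⇔ Accepts A w
mainTheorem2 em A Qd ldba Ord isOrd w = mk⇔ summary-even⇒accepts accepts⇒summary-even
  where open LimitDeterministic em A Qd ldba Ord isOrd w
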